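{- Let $\Delta$ be a repository, $C\in\mathrm{dom}(\Delta)$ with $C:\Delta(C)\in\Delta$, $E_1,\dots,E_m$ combinatory terms, $\tau\in\mathbb{T}_C$ and $k\in\mathbb{N}$. The following are equivalent: (1) $\Delta\vdash_k C\,E_1\cdots E_m:\tau$; (2) there exists a set of paths $P\subseteq\mathbb{P}_m\big(\bigcap\{S(\Delta(C))\mid \mathrm{level}(S)\le k,\ \mathrm{atoms}(S)\subseteq\mathrm{atoms}(\Delta)\cup\mathrm{atoms}(\tau)\}\big)$ such that (a) $\bigcap_{\pi\in P}\mathrm{tgt}_m(\pi)\le\tau$ and (b) $\Delta\vdash_k E_i:\bigcap_{\pi\in P}\mathrm{arg}_i(\pi)$ for $1\le i\le m$.
   Context: Types $\mathbb{T}_C$: $\tau::=a\mid\alpha\mid\omega\mid\tau_1\to\tau_2\mid\tau_1\cap\tau_2\mid c(\tau)$ ($a$ constants, $\alpha$ type variables, $c$ unary constructors). Subtyping $\le$: least preorder with $\sigma\le\omega$; $\omega\le\omega\to\omega$; $\sigma\cap\tau\le\sigma$; $\sigma\cap\tau\le\tau$; $\sigma\le\tau_1,\sigma\le\tau_2\Rightarrow\sigma\le\tau_1\cap\tau_2$; $(\sigma\to\tau_1)\cap(\sigma\to\tau_2)\le\sigma\to\tau_1\cap\tau_2$; $\sigma_2\le\sigma_1,\tau_1\le\tau_2\Rightarrow\sigma_1\to\tau_1\le\sigma_2\to\tau_2$; $\tau_1\le\tau_2\Rightarrow c(\tau_1)\le c(\tau_2)$; $c(\tau_1)\cap c(\tau_2)\le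 c(\tau_1\cap\tau_2)$. Level: $0$ for $\omega,a,\alpha$; $\mathrm{level}(c(\tau))=1+\mathrm{level}(\tau)$; $\mathrm{level}(\sigma\to\tau)=1+\max(\mathrm{level}(\sigma),\mathrm{level}(\tau))$; $\mathrm{level}(\sigma\cap\tau)=\max(\mathrm{level}(\sigma),\mathrm{level}(\tau))$. A substitution $S$ maps type variables to types (extended homomorphically), $\mathrm{level}(S)=\max\{\mathrm{level}(S(\alpha))\mid\alpha\in\mathrm{dom}(S)\}$. A repository $\Delta$ is a finite set of typed combinator names $C:\tau$ (distinct names; $\Delta(C)$ is the type of $C$). Combinatory terms $E::=C\mid(E\,E')$, application left associative. Rules of $\mathsf{BCL}_k(\mathbb{T}_C)$: $C:\tau\in\Delta$, $\mathrm{level}(S)\le k\Rightarrow\Delta\vdash_k C:S(\tau)$; from $\Delta\vdash_k E:\sigma\to\tau$, $\Delta\vdash_k E':\sigma$ infer $\Delta\vdash_k E\,E':\tau$; $\cap$-introduction; subsumption along $\le$. Paths: $\pi::=a\mid\alpha\mid\sigma\to\pi\mid c(\omega)\mid c(\pi)$ ($\sigma$ any type). Paths of a type: $\mathbb{P}(a)=\{a\}$, $\mathbb{P}(\alpha)=\{\alpha\}$, $\mathbb{P}(\omega)=\emptyset$, $\mathbb{P}(\sigma\to\tau)=\{\sigma\to\pi\mid\pi\in\mathbb{P}(\tau)\}$, $\mathbb{P}(\sigma\cap\tau)=\mathbb{P}(\sigma)\cup\mathbb{P}(\tau)$, $\mathbb{P}(c(\tau))=\{c(\omega)\}$ if $\mathbb{P}(\tau)=\emptyset$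 and $\{c(\pi)\mid\pi\in\mathbb{P}(\tau)\}$ otherwise. A path $\pi$ has arity at least $m$ if $\pi\equiv\sigma_1\to\cdots\to\sigma_m\to\tau'$; then $\mathrm{arg}_i(\pi)=\sigma_i$ ($1\le i\le m$) and $\mathrm{tgt}_m(\pi)=\tau'$. $\mathbb{P}_m(\tau)$ is the set of paths in $\mathbb{P}(\tau)$ of arity at least $m$. $\mathrm{atoms}(\tau)$ is the set of constants, variables and constructor names occurring in $\tau$; $\mathrm{atoms}(S)=\bigcup_{\alpha\in\mathrm{dom}(S)}\mathrm{atoms}(S(\alpha))$; $\mathrm{atoms}(\Delta)=\bigcup_{C:\tau\in\Delta}\mathrm{atoms}(\tau)$. An empty intersection denotes $\omega$. -}

module Defs where

open import Data.Nat using (ℕ; zero; suc; _≤_; _⊔_; _≡ᵇ_)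
open import Data.Bool using (if_then_else_)
open import Data.Fin using (Fin; zero; suc)
open import Data.Product using (_×_; _,_; proj₁; Σ; ∃)
open import Data.List using (List; []; _∷_; _++_; map; foldl; concatMap)
open import Data.Vec using (Vec)
import Data.Vec as Vec
open import Data.List.Membership.Propositional using (_∈_)
open import Data.List.Relation.Unary.All using (All)
open import Data.List.Relation.Unary.Unique.Propositional using (Unique)
open import Data.List.Relation.Binary.Subset.Propositional using (_⊆_)
open import Data.Unit using (⊤)
open import Data.Empty using (⊥)

data Ty : Set where
  con  : ℕ → Ty
  var  : ℕ → Ty
  ω    : Ty
  _⇒_  : Ty → Ty → Ty
  _∩_  : Ty → Ty → Ty
  ctor : ℕ → Ty → Ty

infixr 7 _⇒_
infixl 8 _∩_

data _≤ₜ_ : Ty → Ty → Set where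
  ≤-refl   : ∀ {σ} → σ ≤ₜ σ
  ≤-trans  : ∀ {σ τ ρ} → σ ≤ₜ τ → τ ≤ₜ ρ → σ ≤ₜ ρ
  ≤-ω      : ∀ {σ} → σ ≤ₜ ω
  ω≤ω⇒ω    : ω ≤ₜ (ω ⇒ ω)
  ∩-lb₁    : ∀ {σ τ} → (σ ∩ τ) ≤ₜ σ
  ∩-lb₂    : ∀ {σ τ} → (σ ∩ τ) ≤ₜ τ
  ∩-glb    : ∀ {σ τ₁ τ₂} → σ ≤ₜ τ₁ → σ ≤ₜ τ₂ → σ ≤ₜ (τ₁ ∩ τ₂)
  ⇒-dist   : ∀ {σ τ₁ τ₂} → ((σ ⇒ τ₁) ∩ (σ ⇒ τ₂)) ≤ₜ (σ ⇒ (τ₁ ∩ τ₂))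
  ⇒-mono   : ∀ {σ₁ σ₂ τ₁ τ₂} → σ₂ ≤ₜ σ₁ → τ₁ ≤ₜ τ₂ → (σ₁ ⇒ τ₁) ≤ₜ (σ₂ ⇒ τ₂)
  c-mono   : ∀ {c τ₁ τ₂} → τ₁ ≤ₜ τ₂ → ctor c τ₁ ≤ₜ ctor c τ₂
  c-dist   : ∀ {c τ₁ τ₂} → (ctor c τ₁ ∩ ctor c τ₂) ≤ₜ ctor c (τ₁ ∩ τ₂)

level : Ty → ℕ
level (con _)    = 0
level (var _)    = 0
level ω          = 0
level (σ ⇒ τ)    = suc (level σ ⊔ level τ)
level (σ ∩ τ)    = level σ ⊔ level τ
level (ctor _ τ) = suc (level τ)

-- Substitutions: finite maps from type variables to types, given as an
-- association list (first entry for a variable wins); dom(S) is the set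
-- of keys.

Subst : Set
Subst = List (ℕ × Ty)

dom : Subst → List ℕ
dom = map proj₁

lookupS : Subst → ℕ → Ty
lookupS []             α = var α
lookupS ((β , σ) ∷ S)  α = if α ≡ᵇ β then σ else lookupS S α

applyS : Subst → Ty → Ty
applyS S (con a)    = con a
applyS S (var α)    = lookupS S α
applyS S ω          = ω
applyS S (σ ⇒ τ)    = applyS S σ ⇒ applyS S τ
applyS S (σ ∩ τ)    = applyS S σ ∩ applyS S τ
applyS S (ctor c τ) = ctor c (applyS S τ)

-- level(S) ≤ k  (max over dom(S); max of the empty set is 0)
LevelS≤ : Subst → ℕ → Set
LevelS≤ S k = All (λ α → level (lookupS S α) ≤ k) (dom S)

data Atom : Set where
  aConst : ℕ → Atom
  aVar   : ℕ → Atom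
  aCtor  : ℕ → Atom

atoms : Ty → List Atom
atoms (con a)    = aConst a ∷ []
atoms (var α)    = aVar α ∷ []
atoms ω          = []
atoms (σ ⇒ τ)    = atoms σ ++ atoms τ
atoms (σ ∩ τ)    = atoms σ ++ atoms τ
atoms (ctor c τ) = aCtor c ∷ atoms τ

atomsS : Subst → List Atom
atomsS S = concatMap (λ α → atoms (lookupS S α)) (dom S)

Repository : Set
Repository = List (ℕ × Ty)

WellFormedRepo : Repository → Set
WellFormedRepo Δ = Unique (map proj₁ Δ)

atomsΔ : Repository → List Atom
atomsΔ Δ = concatMap (λ p → atoms (Data.Product.proj₂ p)) Δ

data Term : Set where
  comb : ℕ → Term
  app  : Term → Term → Term

applyAll : Term → {m : ℕ} → Vec Term m → Term
applyAll E Es = Vec.foldl (λ _ → Term) app E Es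

data _⊢[_]_∶_ (Δ : Repository) (k : ℕ) : Term → Ty → Set where
  var-rule : ∀ {C τ S} → (C , τ) ∈ Δ → LevelS≤ S k →
             Δ ⊢[ k ] comb C ∶ applyS S τ
  →E       : ∀ {E E' σ τ} → Δ ⊢[ k ] E ∶ (σ ⇒ τ) → Δ ⊢[ k ] E' ∶ σ →
             Δ ⊢[ k ] app E E' ∶ τ
  ∩I       : ∀ {E σ τ} → Δ ⊢[ k ] E ∶ σ → Δ ⊢[ k ] E ∶ τ →
             Δ ⊢[ k ] E ∶ (σ ∩ τ)
  ≤-rule   : ∀ {E σ τ} → Δ ⊢[ k ] E ∶ σ → σ ≤ₜ τ → Δ ⊢[ k ] E ∶ τ

ctorPaths : ℕ → List Ty → List Ty
ctorPaths c []          = ctor c ω ∷ []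
ctorPaths c ps@(_ ∷ _)  = map (ctor c) ps

paths : Ty → List Ty
paths (con a)    = con a ∷ []
paths (var α)    = var α ∷ []
paths ω          = []
paths (σ ⇒ τ)    = map (σ ⇒_) (paths τ)
paths (σ ∩ τ)    = paths σ ++ paths τ
paths (ctor c τ) = ctorPaths c (paths τ)

ArityAtLeast : ℕ → Ty → Set
ArityAtLeast zero    π       = ⊤
ArityAtLeast (suc m) (σ ⇒ τ) = ArityAtLeast m τ
ArityAtLeast (suc m) _       = ⊥

-- arg_i(π) for i ∈ {1..m} (Fin m, 0-based); only meaningful when arity ≥ m
arg : ∀ {m} → Fin m → Ty → Ty
arg zero    (σ ⇒ τ) = σ
arg (suc i) (σ ⇒ τ) = arg i τ
arg _       _       = ω

-- tgt_m(π); only meaningful when arity ≥ m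
tgt : ℕ → Ty → Ty
tgt zero    π       = π
tgt (suc m) (σ ⇒ τ) = tgt m τ
tgt (suc m) _       = ω

⋂ : List Ty → Ty
⋂ []           = ω
⋂ (σ ∷ [])     = σ
⋂ (σ ∷ τ ∷ ts) = σ ∩ ⋂ (τ ∷ ts)

-- π ∈ P_m( ⋂ { S(Δ(C)) | level(S) ≤ k, atoms(S) ⊆ atoms(Δ) ∪ atoms(τ) } )
-- Since P(σ ∩ τ) = P(σ) ∪ P(τ), this means: π ∈ P_m(S(Δ(C))) for some
-- admissible S.
InPm⋂ : Repository → ℕ → Ty → ℕ → Ty → Ty → Set
InPm⋂ Δ k τ m τC π =
  Σ Subst λ S → LevelS≤ S k × (atomsS S ⊆ (atomsΔ Δ ++ atoms τ)) ×
                (π ∈ paths (applyS S τC)) × ArityAtLeast m π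

-- A derivation of C E₁ ⋯ Eₘ : τ inverts to C : σ₁ ⇒ ⋯ ⇒ σₘ ⇒ τ with Eᵢ : σᵢ, and
-- a type of C lies above the intersection of the paths of finitely many
-- instances S(Δ(C)).  For an intersection ⋂ Π of paths, ⋂ Π ≤ σ ⇒ τ can only
-- be witnessed by arrows of Π whose domains lie above σ and whose targets meet
-- below τ; peeling off the m arguments this way selects P.  The bound on
-- atoms(S) comes from erasing every atom outside atoms(Δ) ∪ atoms(τ) (and every
-- constructor term headed by one) to ω: erasure is monotone, does not raise
-- levels and fixes τ and Δ, so it maps derivations to derivations.  Conversely,
-- C : ⋂ P and m uses of ⇒-dist give C E₁ ⋯ Eₘ : ⋂ tgtₘ(P).

module Submission where

open import Defs
open import Data.Nat using (ℕ; zero; suc; _≡ᵇ_)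
import Data.Nat as ℕ
import Data.Nat.Properties as ℕ
open import Data.Bool using (true; false; T)
open import Data.Fin using (Fin; zero; suc)
open import Data.Product using (_×_; _,_; Σ; proj₁; proj₂; uncurry; map₁; map₂)
open import Data.Sum using (_⊎_; inj₁; inj₂)
open import Data.List using (List; []; _∷_; _++_; map)
open import Data.List.Properties using (map-id; map-∘; map-++)
open import Data.List.Membership.Propositional using (_∈_; find; lose)
open import Data.List.Membership.Propositional.Properties
  using (∈-++⁻; ∈-++⁺ˡ; ∈-++⁺ʳ; ∈-map⁻; ∈-map⁺; ∈-concatMap⁺; ∈-concatMap⁻)
import Data.List.Membership.DecPropositional as DecMembership
open import Data.List.Relation.Unary.All using (All; []; _∷_)
import Data.List.Relation.Unary.All as All
open import Data.List.Relation.Unary.All.Properties using (++⁺; anti-mono)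
  renaming (map⁺ to All-map⁺; map⁻ to All-map⁻)
open import Data.List.Relation.Unary.Any using (here; there)
open import Data.List.Relation.Unary.AllPairs using ([]; _∷_)
open import Data.List.Relation.Binary.Subset.Propositional using (_⊆_)
open import Data.Vec using (Vec; []; _∷_; lookup)
import Data.Vec as Vec
open import Data.Vec.Properties using (lookup-map)
open import Data.Unit using (⊤; tt)
open import Data.Empty using (⊥; ⊥-elim)
open import Function using (_∘_; id)
open import Function.Bundles using (_⇔_; mk⇔)
open import Relation.Nullary using (Dec; yes; no)
open import Relation.Nullary.Decidable using (map′)
open import Relation.Binary.Definitions using (DecidableEquality)
open import Relation.Binary.PropositionalEquality
  using (_≡_; refl; sym; trans; cong; cong₂; subst)

private
  variable
    σ σ′ τ τ′ ρ : Ty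
    Γ Π : List Ty
    k n : ℕ

arrow : Ty × Ty → Ty
arrow = uncurry _⇒_

∩-mono : σ ≤ₜ σ′ → τ ≤ₜ τ′ → (σ ∩ τ) ≤ₜ (σ′ ∩ τ′)
∩-mono p q = ∩-glb (≤-trans ∩-lb₁ p) (≤-trans ∩-lb₂ q)

∩-⇒ : ∀ {σ₁ σ₂ τ₁ τ₂} → ((σ₁ ⇒ τ₁) ∩ (σ₂ ⇒ τ₂)) ≤ₜ (σ₁ ∩ σ₂ ⇒ τ₁ ∩ τ₂)
∩-⇒ = ≤-trans (∩-mono (⇒-mono ∩-lb₁ ≤-refl) (⇒-mono ∩-lb₂ ≤-refl)) ⇒-dist

⋂-lb : ∀ {xs x} → x ∈ xs → ⋂ xs ≤ₜ x
⋂-lb {_ ∷ []}    (here refl) = ≤-refl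
⋂-lb {_ ∷ _ ∷ _} (here refl) = ∩-lb₁
⋂-lb {_ ∷ _ ∷ _} (there x∈) = ≤-trans ∩-lb₂ (⋂-lb x∈)

⋂-glb : ∀ {xs} → All (σ ≤ₜ_) xs → σ ≤ₜ ⋂ xs
⋂-glb []           = ≤-ω
⋂-glb (p ∷ [])     = p
⋂-glb (p ∷ q ∷ ps) = ∩-glb p (⋂-glb (q ∷ ps))

⋂-⊆ : ∀ {xs ys} → ys ⊆ xs → ⋂ xs ≤ₜ ⋂ ys
⋂-⊆ ys⊆xs = ⋂-glb (All.tabulate (⋂-lb ∘ ys⊆xs))

⋂-∷ : ∀ x xs → (x ∩ ⋂ xs) ≤ₜ ⋂ (x ∷ xs)
⋂-∷ x []      = ∩-lb₁
⋂-∷ x (_ ∷ _) = ≤-refl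

⋂-∷⁻ : ∀ x xs → ⋂ (x ∷ xs) ≤ₜ (x ∩ ⋂ xs)
⋂-∷⁻ x []      = ∩-glb ≤-refl ≤-ω
⋂-∷⁻ x (_ ∷ _) = ≤-refl

⋂-++ : ∀ xs ys → ⋂ xs ≤ₜ σ → ⋂ ys ≤ₜ τ → ⋂ (xs ++ ys) ≤ₜ (σ ∩ τ)
⋂-++ xs ys p q =
  ∩-glb (≤-trans (⋂-⊆ {xs ++ ys} {xs} ∈-++⁺ˡ) p) (≤-trans (⋂-⊆ {xs ++ ys} {ys} (∈-++⁺ʳ xs)) q)

⋂-arrows : ∀ L → ⋂ (map arrow L) ≤ₜ (⋂ (map proj₁ L) ⇒ ⋂ (map proj₂ L))
⋂-arrows []      = ω≤ω⇒ω
⋂-arrows (p ∷ L) =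
  ≤-trans (⋂-∷⁻ (arrow p) (map arrow L))
  (≤-trans (∩-mono ≤-refl (⋂-arrows L))
  (≤-trans ∩-⇒
    (⇒-mono (⋂-∷⁻ (proj₁ p) (map proj₁ L)) (⋂-∷ (proj₂ p) (map proj₂ L)))))

⋂-⇒ʳ : ∀ σ xs → ⋂ (map (σ ⇒_) xs) ≤ₜ (σ ⇒ ⋂ xs)
⋂-⇒ʳ σ []       = ≤-trans ω≤ω⇒ω (⇒-mono ≤-ω ≤-refl)
⋂-⇒ʳ σ (x ∷ xs) =
  ≤-trans (⋂-∷⁻ (σ ⇒ x) (map (σ ⇒_) xs))
  (≤-trans (∩-mono ≤-refl (⋂-⇒ʳ σ xs))
  (≤-trans ⇒-dist (⇒-mono ≤-refl (⋂-∷ x xs))))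

⋂-ctor : ∀ c x xs → ⋂ (map (ctor c) (x ∷ xs)) ≤ₜ ctor c (⋂ (x ∷ xs))
⋂-ctor c x []       = ≤-refl
⋂-ctor c x (y ∷ xs) = ≤-trans (∩-mono ≤-refl (⋂-ctor c y xs)) c-dist

≤-paths : ∀ σ {π} → π ∈ paths σ → σ ≤ₜ π
≤-paths (con _)    (here refl) = ≤-refl
≤-paths (var _)    (here refl) = ≤-refl
≤-paths (σ ⇒ τ)    π∈ with ∈-map⁻ (σ ⇒_) π∈
... | _ , π′∈ , refl = ⇒-mono ≤-refl (≤-paths τ π′∈)
≤-paths (σ ∩ τ)    π∈ with ∈-++⁻ (paths σ) π∈
... | inj₁ π∈σ = ≤-trans ∩-lb₁ (≤-paths σ π∈σ)
... | inj₂ π∈τ = ≤-trans ∩-lb₂ (≤-paths τ π∈τ)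
≤-paths (ctor c τ) π∈ = ctor-case (paths τ) (≤-paths τ) π∈
  where
  ctor-case : ∀ ps → (∀ {π} → π ∈ ps → τ ≤ₜ π) →
              ∀ {π} → π ∈ ctorPaths c ps → ctor c τ ≤ₜ π
  ctor-case []      _    (here refl) = c-mono ≤-ω
  ctor-case (_ ∷ _) τ≤ps π∈ with ∈-map⁻ (ctor c) π∈
  ... | _ , π′∈ , refl = c-mono (τ≤ps π′∈)

⋂-paths : ∀ σ → ⋂ (paths σ) ≤ₜ σ
⋂-paths (con _)    = ≤-refl
⋂-paths (var _)    = ≤-refl
⋂-paths ω          = ≤-refl
⋂-paths (σ ⇒ τ)    = ≤-trans (⋂-⇒ʳ σ (paths τ)) (⇒-mono ≤-refl (⋂-paths τ))
⋂-paths (σ ∩ τ)    = ⋂-++ (paths σ) (paths τ) (⋂-paths σ) (⋂-paths τ)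
⋂-paths (ctor c τ) = ctor-case (paths τ) (⋂-paths τ)
  where
  ctor-case : ∀ ps → ⋂ ps ≤ₜ τ → ⋂ (ctorPaths c ps) ≤ₜ ctor c τ
  ctor-case []       ω≤τ  = c-mono ω≤τ
  ctor-case (p ∷ ps) ps≤τ = ≤-trans (⋂-ctor c p ps) (c-mono ps≤τ)

Strict : Ty → Set
Strict (σ ⇒ τ) = Strict τ
Strict (σ ∩ τ) = ⊥
Strict _       = ⊤

paths-strict : ∀ σ {π} → π ∈ paths σ → Strict π
paths-strict (con _)    (here refl) = tt
paths-strict (var _)    (here refl) = tt
paths-strict (σ ⇒ τ)    π∈ with ∈-map⁻ (σ ⇒_) π∈
... | _ , π′∈ , refl = paths-strict τ π′∈
paths-strict (σ ∩ τ)    π∈ with ∈-++⁻ (paths σ) π∈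
... | inj₁ π∈σ = paths-strict σ π∈σ
... | inj₂ π∈τ = paths-strict τ π∈τ
paths-strict (ctor c τ) π∈ = ctor-case (paths τ) π∈
  where
  ctor-case : ∀ ps {π} → π ∈ ctorPaths c ps → Strict π
  ctor-case []      (here refl) = tt
  ctor-case (_ ∷ _) π∈ with ∈-map⁻ (ctor c) π∈
  ... | _ , _ , refl = tt

-- Inversion of subtyping against an arrow

comps : Ty → List Ty
comps (σ ∩ τ) = comps σ ++ comps τ
comps σ       = σ ∷ []

ArrowsAbove : List Ty → Ty → List (Ty × Ty) → Set
ArrowsAbove Γ ρ = All (λ p → arrow p ∈ Γ × ρ ≤ₜ proj₁ p)

-- A trace of ⋂ Γ ≤ₜ τ recording only how arrow goals are met by arrows of Γ;
-- nothing else survives transitivity or is needed to invert against an arrow.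
infix 4 _≼_
_≼_ : List Ty → Ty → Set
Γ ≼ con _    = ⊤
Γ ≼ var _    = ⊤
Γ ≼ ω        = ⊤
Γ ≼ ρ ⇒ τ    = Σ (List (Ty × Ty)) λ L → ArrowsAbove Γ ρ L × ⋂ (map proj₂ L) ≤ₜ τ
Γ ≼ τ₁ ∩ τ₂  = Γ ≼ τ₁ × Γ ≼ τ₂
Γ ≼ ctor _ _ = ⊤

≼-⊆ : ∀ {Γ Γ′} → (∀ {p} → arrow p ∈ Γ → arrow p ∈ Γ′) → ∀ τ → Γ ≼ τ → Γ′ ≼ τ
≼-⊆ Γ⊆Γ′ (con _)    _                  = tt
≼-⊆ Γ⊆Γ′ (var _)    _                  = tt
≼-⊆ Γ⊆Γ′ ω          _                  = tt
≼-⊆ Γ⊆Γ′ (ρ ⇒ τ)    (L , L-above , L≤) = L , All.map (map₁ Γ⊆Γ′) L-above , L≤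
≼-⊆ Γ⊆Γ′ (τ₁ ∩ τ₂)  (≼τ₁ , ≼τ₂)        = ≼-⊆ Γ⊆Γ′ τ₁ ≼τ₁ , ≼-⊆ Γ⊆Γ′ τ₂ ≼τ₂
≼-⊆ Γ⊆Γ′ (ctor _ _) _                  = tt

comps-≼ : ∀ σ → comps σ ≼ σ
comps-≼ (con _)    = tt
comps-≼ (var _)    = tt
comps-≼ ω          = tt
comps-≼ (σ ⇒ τ)    = (σ , τ) ∷ [] , (here refl , ≤-refl) ∷ [] , ≤-refl
comps-≼ (σ ∩ τ)    = ≼-⊆ ∈-++⁺ˡ σ (comps-≼ σ) , ≼-⊆ (∈-++⁺ʳ (comps σ)) τ (comps-≼ τ)
comps-≼ (ctor _ _) = tt

≼-comps : ∀ τ {x} → x ∈ comps τ → Γ ≼ τ → Γ ≼ x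
≼-comps (τ₁ ∩ τ₂)  x∈ (≼τ₁ , ≼τ₂) with ∈-++⁻ (comps τ₁) x∈
... | inj₁ x∈τ₁ = ≼-comps τ₁ x∈τ₁ ≼τ₁
... | inj₂ x∈τ₂ = ≼-comps τ₂ x∈τ₂ ≼τ₂
≼-comps (con _)    (here refl) ≼x = ≼x
≼-comps (var _)    (here refl) ≼x = ≼x
≼-comps ω          (here refl) ≼x = ≼x
≼-comps (_ ⇒ _)    (here refl) ≼x = ≼x
≼-comps (ctor _ _) (here refl) ≼x = ≼x

≼⇒-dom : ρ ≤ₜ σ → Γ ≼ σ ⇒ τ → Γ ≼ ρ ⇒ τ
≼⇒-dom ρ≤σ (L , L-above , L≤) = L , All.map (map₂ (≤-trans ρ≤σ)) L-above , L≤

≼⇒-cod : τ ≤ₜ τ′ → Γ ≼ σ ⇒ τ → Γ ≼ σ ⇒ τ′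
≼⇒-cod τ≤τ′ (L , L-above , L≤) = L , L-above , ≤-trans L≤ τ≤τ′

≼⇒-⋂ : ∀ {τs} → All (λ τ → Γ ≼ σ ⇒ τ) τs → Γ ≼ σ ⇒ ⋂ τs
≼⇒-⋂ [] = [] , [] , ≤-refl
≼⇒-⋂ {τs = τ ∷ τs} ((K , K-above , K≤) ∷ ≼τs) with ≼⇒-⋂ ≼τs
... | L , L-above , L≤ =
  K ++ L , ++⁺ K-above L-above ,
  subst (λ ts → ⋂ ts ≤ₜ ⋂ (τ ∷ τs)) (sym (map-++ proj₂ K L))
    (≤-trans (⋂-++ (map proj₂ K) (map proj₂ L) K≤ L≤) (⋂-∷ τ τs))

≼-trans : ∀ {Γ τ} ρ → Γ ≼ τ → comps τ ≼ ρ → Γ ≼ ρ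
≼-trans (con _)    _   _ = tt
≼-trans (var _)    _   _ = tt
≼-trans ω          _   _ = tt
≼-trans {Γ} {τ} (ρ ⇒ π) ≼τ (L , L-above , L≤) =
  ≼⇒-cod L≤ (≼⇒-⋂ (All-map⁺ (All.map through L-above)))
  where
  through : ∀ {p} → arrow p ∈ comps τ × ρ ≤ₜ proj₁ p → Γ ≼ ρ ⇒ proj₂ p
  through (p∈ , ρ≤) = ≼⇒-dom ρ≤ (≼-comps τ p∈ ≼τ)
≼-trans (ρ₁ ∩ ρ₂)  ≼τ (≼ρ₁ , ≼ρ₂) = ≼-trans ρ₁ ≼τ ≼ρ₁ , ≼-trans ρ₂ ≼τ ≼ρ₂
≼-trans (ctor _ _) _   _ = tt

≤ₜ⇒≼ : σ ≤ₜ τ → comps σ ≼ τ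
≤ₜ⇒≼ {σ} ≤-refl                 = comps-≼ σ
≤ₜ⇒≼ {τ = ρ} (≤-trans p q)      = ≼-trans ρ (≤ₜ⇒≼ p) (≤ₜ⇒≼ q)
≤ₜ⇒≼ ≤-ω                        = tt
≤ₜ⇒≼ ω≤ω⇒ω                      = [] , [] , ≤-refl
≤ₜ⇒≼ {σ ∩ _} ∩-lb₁              = ≼-⊆ ∈-++⁺ˡ σ (comps-≼ σ)
≤ₜ⇒≼ {σ ∩ τ} ∩-lb₂              = ≼-⊆ (∈-++⁺ʳ (comps σ)) τ (comps-≼ τ)
≤ₜ⇒≼ (∩-glb p q)                = ≤ₜ⇒≼ p , ≤ₜ⇒≼ q
≤ₜ⇒≼ (⇒-dist {σ} {τ₁} {τ₂})     =
  (σ , τ₁) ∷ (σ , τ₂) ∷ [] , (here refl , ≤-refl) ∷ (there (here refl) , ≤-refl) ∷ [] , ≤-refl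
≤ₜ⇒≼ (⇒-mono {σ₁} {τ₁ = τ₁} p q) = (σ₁ , τ₁) ∷ [] , (here refl , p) ∷ [] , q
≤ₜ⇒≼ (c-mono _)                 = tt
≤ₜ⇒≼ c-dist                     = tt

strict-comps : Strict σ → comps σ ≡ σ ∷ []
strict-comps {con _}    _ = refl
strict-comps {var _}    _ = refl
strict-comps {ω}        _ = refl
strict-comps {_ ⇒ _}    _ = refl
strict-comps {ctor _ _} _ = refl

arrow∈comps-⋂ : ∀ Π → All Strict Π → ∀ {p} → arrow p ∈ comps (⋂ Π) → arrow p ∈ Π
arrow∈comps-⋂ []           []                (here ())
arrow∈comps-⋂ (π ∷ [])     (sπ ∷ [])     p∈ = subst (_ ∈_) (strict-comps sπ) p∈
arrow∈comps-⋂ (π ∷ π′ ∷ Π) (sπ ∷ strict) p∈ with ∈-++⁻ (comps π) p∈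
... | inj₁ p∈π = ∈-++⁺ˡ (subst (_ ∈_) (strict-comps sπ) p∈π)
... | inj₂ p∈Π = there (arrow∈comps-⋂ (π′ ∷ Π) strict p∈Π)

⋂-≤-⇒ : All Strict Π → ⋂ Π ≤ₜ (ρ ⇒ τ) → Π ≼ ρ ⇒ τ
⋂-≤-⇒ {Π} {ρ} {τ} strict le = ≼-⊆ (arrow∈comps-⋂ Π strict) (ρ ⇒ τ) (≤ₜ⇒≼ le)

strict-targets : ∀ {L} → All Strict Π → ArrowsAbove Π ρ L → All Strict (map proj₂ L)
strict-targets strict = All-map⁺ ∘ All.map (All.lookup strict ∘ proj₁)

infixr 7 _⇒*_
_⇒*_ : Vec Ty n → Ty → Ty
[]       ⇒* τ = τ
(σ ∷ σs) ⇒* τ = σ ⇒ (σs ⇒* τ)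

map-arrow-arg : ∀ (i : Fin n) L → map (arg (suc i)) (map arrow L) ≡ map (arg i) (map proj₂ L)
map-arrow-arg i L = trans (sym (map-∘ L)) (map-∘ L)

map-arrow-tgt : ∀ n L → map (tgt (suc n)) (map arrow L) ≡ map (tgt n) (map proj₂ L)
map-arrow-tgt n L = trans (sym (map-∘ L)) (map-∘ L)

⊆-map⁻ : ∀ {A B : Set} (f : A → B) {xs} ys → ys ⊆ map f xs →
         Σ (List A) λ zs → zs ⊆ xs × map f zs ≡ ys
⊆-map⁻ f []       _     = [] , (λ ()) , refl
⊆-map⁻ f (y ∷ ys) ys⊆ with ∈-map⁻ f (ys⊆ (here refl)) | ⊆-map⁻ f ys (ys⊆ ∘ there)
... | z , z∈ , refl | zs , zs⊆ , refl = z ∷ zs , (λ { (here refl) → z∈ ; (there p) → zs⊆ p }) , refl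

SelectedPaths : ∀ {n} → List Ty → Vec Ty n → Ty → List Ty → Set
SelectedPaths {n} Π σs τ P =
  P ⊆ Π × All (ArityAtLeast n) P ×
  ((i : Fin n) → lookup σs i ≤ₜ ⋂ (map (arg i) P)) × ⋂ (map (tgt n) P) ≤ₜ τ

select-paths : ∀ {n} (σs : Vec Ty n) τ Π → All Strict Π → ⋂ Π ≤ₜ (σs ⇒* τ) →
               Σ (List Ty) (SelectedPaths Π σs τ)
select-paths []       τ Π _ Π≤τ =
  Π , id , All.tabulate (λ _ → tt) , (λ ()) , subst (λ ts → ⋂ ts ≤ₜ τ) (sym (map-id Π)) Π≤τ
select-paths {suc n} (σ ∷ σs) τ Π strict Π≤ with ⋂-≤-⇒ strict Π≤
... | L , L-above , L≤ with select-paths σs τ (map proj₂ L) (strict-targets strict L-above) L≤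
... | P′ , P′⊆ , P′-arity , P′-args , P′-tgt with ⊆-map⁻ proj₂ P′ P′⊆
... | Q , Q⊆L , refl =
  map arrow Q ,
  All.lookup (All-map⁺ {P = _∈ Π} (anti-mono Q⊆L (All.map proj₁ L-above))) ,
  All-map⁺ (All-map⁻ P′-arity) ,
  args ,
  subst (λ ts → ⋂ ts ≤ₜ τ) (sym (map-arrow-tgt n Q)) P′-tgt
  where
  args : (i : Fin (suc n)) → lookup (σ ∷ σs) i ≤ₜ ⋂ (map (arg i) (map arrow Q))
  args zero    = ⋂-glb (All-map⁺ (All-map⁺ (anti-mono Q⊆L (All.map proj₂ L-above))))
  args (suc i) = subst (λ ts → lookup σs i ≤ₜ ⋂ ts) (sym (map-arrow-arg i Q)) (P′-args i)

arity-suc⇒arrows : ∀ P → All (ArityAtLeast (suc n)) P →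
                   Σ (List (Ty × Ty)) λ L → map arrow L ≡ P × All (ArityAtLeast n) (map proj₂ L)
arity-suc⇒arrows []             []              = [] , refl , []
arity-suc⇒arrows ((σ ⇒ τ) ∷ P) (τ-arity ∷ arity) with arity-suc⇒arrows P arity
... | L , refl , L-arity = (σ , τ) ∷ L , refl , τ-arity ∷ L-arity
arity-suc⇒arrows (con _ ∷ _)    (() ∷ _)
arity-suc⇒arrows (var _ ∷ _)    (() ∷ _)
arity-suc⇒arrows (ω ∷ _)        (() ∷ _)
arity-suc⇒arrows ((_ ∩ _) ∷ _)  (() ∷ _)
arity-suc⇒arrows (ctor _ _ ∷ _) (() ∷ _)

module _ {Δ : Repository} {k : ℕ} where

  ⊢-⋂ : ∀ {E xs} → Δ ⊢[ k ] E ∶ σ → All (Δ ⊢[ k ] E ∶_) xs → Δ ⊢[ k ] E ∶ ⋂ xs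
  ⊢-⋂ ⊢E []             = ≤-rule ⊢E ≤-ω
  ⊢-⋂ ⊢E (⊢x ∷ [])      = ⊢x
  ⊢-⋂ ⊢E (⊢x ∷ ⊢y ∷ ⊢s) = ∩I ⊢x (⊢-⋂ ⊢E (⊢y ∷ ⊢s))

  app-inversion : ∀ {E E′} → Δ ⊢[ k ] app E E′ ∶ τ →
                  Σ Ty λ σ → Δ ⊢[ k ] E ∶ (σ ⇒ τ) × Δ ⊢[ k ] E′ ∶ σ
  app-inversion (→E ⊢E ⊢E′) = _ , ⊢E , ⊢E′
  app-inversion (∩I ⊢₁ ⊢₂) with app-inversion ⊢₁ | app-inversion ⊢₂
  ... | σ₁ , ⊢E₁ , ⊢E′₁ | σ₂ , ⊢E₂ , ⊢E′₂ =
    σ₁ ∩ σ₂ , ≤-rule (∩I ⊢E₁ ⊢E₂) ∩-⇒ , ∩I ⊢E′₁ ⊢E′₂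
  app-inversion (≤-rule ⊢app ≤τ) with app-inversion ⊢app
  ... | σ , ⊢E , ⊢E′ = σ , ≤-rule ⊢E (⇒-mono ≤-refl ≤τ) , ⊢E′

  applyAll-inversion : ∀ {n} H (Es : Vec Term n) → Δ ⊢[ k ] applyAll H Es ∶ τ →
    Σ (Vec Ty n) λ σs →
      Δ ⊢[ k ] H ∶ (σs ⇒* τ) × ((i : Fin n) → Δ ⊢[ k ] lookup Es i ∶ lookup σs i)
  applyAll-inversion H []       ⊢H = [] , ⊢H , λ ()
  applyAll-inversion H (E ∷ Es) ⊢HEs with applyAll-inversion (app H E) Es ⊢HEs
  ... | σs , ⊢HE , ⊢Es with app-inversion ⊢HE
  ... | σ , ⊢H , ⊢E = σ ∷ σs , ⊢H , λ { zero → ⊢E ; (suc i) → ⊢Es i }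

  applyAll-paths : ∀ {n} H (Es : Vec Term n) P → All (ArityAtLeast n) P →
    Δ ⊢[ k ] H ∶ ⋂ P → ((i : Fin n) → Δ ⊢[ k ] lookup Es i ∶ ⋂ (map (arg i) P)) →
    Δ ⊢[ k ] applyAll H Es ∶ ⋂ (map (tgt n) P)
  applyAll-paths H [] P _ ⊢H _ = subst (λ ts → Δ ⊢[ k ] H ∶ ⋂ ts) (sym (map-id P)) ⊢H
  applyAll-paths {suc n} H (E ∷ Es) P arity ⊢H ⊢Es with arity-suc⇒arrows P arity
  ... | L , refl , L-arity =
    subst (λ ts → Δ ⊢[ k ] applyAll (app H E) Es ∶ ⋂ ts) (sym (map-arrow-tgt n L))
      (applyAll-paths (app H E) Es (map proj₂ L) L-arity
        (→E (≤-rule ⊢H (⋂-arrows L))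
            (subst (λ ts → Δ ⊢[ k ] E ∶ ⋂ ts) (sym (map-∘ L)) (⊢Es zero)))
        (λ i → subst (λ ts → Δ ⊢[ k ] lookup Es i ∶ ⋂ ts) (map-arrow-arg i L) (⊢Es (suc i))))

-- Erasure of the atoms outside a given set

_≟ᵃ_ : DecidableEquality Atom
aConst a ≟ᵃ aConst b = map′ (cong aConst) (λ { refl → refl }) (a ℕ.≟ b)
aVar α   ≟ᵃ aVar β   = map′ (cong aVar) (λ { refl → refl }) (α ℕ.≟ β)
aCtor c  ≟ᵃ aCtor d  = map′ (cong aCtor) (λ { refl → refl }) (c ℕ.≟ d)
aConst _ ≟ᵃ aVar _   = no λ ()
aConst _ ≟ᵃ aCtor _  = no λ ()
aVar _   ≟ᵃ aConst _ = no λ ()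
aVar _   ≟ᵃ aCtor _  = no λ ()
aCtor _  ≟ᵃ aConst _ = no λ ()
aCtor _  ≟ᵃ aVar _   = no λ ()

open DecMembership _≟ᵃ_ using (_∈?_)

keepIf : ∀ {X : Set} → Dec X → Ty → Ty
keepIf (yes _) σ = σ
keepIf (no _)  _ = ω

keepIf-mono : ∀ {X : Set} (d : Dec X) → σ ≤ₜ τ → keepIf d σ ≤ₜ keepIf d τ
keepIf-mono (yes _) σ≤τ = σ≤τ
keepIf-mono (no _)  _   = ≤-refl

keepIf-∩ : ∀ {X : Set} (d : Dec X) → (σ ∩ τ) ≤ₜ ρ → (keepIf d σ ∩ keepIf d τ) ≤ₜ keepIf d ρ
keepIf-∩ (yes _) σ∩τ≤ρ = σ∩τ≤ρ
keepIf-∩ (no _)  _     = ≤-ω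

keepIf-level : ∀ {X : Set} (d : Dec X) σ → level (keepIf d σ) ℕ.≤ level σ
keepIf-level (yes _) _ = ℕ.≤-refl
keepIf-level (no _)  _ = ℕ.z≤n

atoms-∈Δ : ∀ {Δ C τ} → (C , τ) ∈ Δ → atoms τ ⊆ atomsΔ Δ
atoms-∈Δ C∈ x∈ = ∈-concatMap⁺ (λ p → atoms (proj₂ p)) (lose C∈ x∈)

module Erasure (A : List Atom) where

  erase : Ty → Ty
  erase (con a)    = keepIf (aConst a ∈? A) (con a)
  erase (var α)    = keepIf (aVar α ∈? A) (var α)
  erase ω          = ω
  erase (σ ⇒ τ)    = erase σ ⇒ erase τ
  erase (σ ∩ τ)    = erase σ ∩ erase τ
  erase (ctor c τ) = keepIf (aCtor c ∈? A) (ctor c (erase τ))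

  erase-mono : σ ≤ₜ τ → erase σ ≤ₜ erase τ
  erase-mono ≤-refl        = ≤-refl
  erase-mono (≤-trans p q) = ≤-trans (erase-mono p) (erase-mono q)
  erase-mono ≤-ω           = ≤-ω
  erase-mono ω≤ω⇒ω         = ω≤ω⇒ω
  erase-mono ∩-lb₁         = ∩-lb₁
  erase-mono ∩-lb₂         = ∩-lb₂
  erase-mono (∩-glb p q)   = ∩-glb (erase-mono p) (erase-mono q)
  erase-mono ⇒-dist        = ⇒-dist
  erase-mono (⇒-mono p q)  = ⇒-mono (erase-mono p) (erase-mono q)
  erase-mono (c-mono {c} p) = keepIf-mono (aCtor c ∈? A) (c-mono (erase-mono p))
  erase-mono (c-dist {c})   = keepIf-∩ (aCtor c ∈? A) c-dist

  erase-level : ∀ σ → level (erase σ) ℕ.≤ level σ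
  erase-level (con a)    = keepIf-level (aConst a ∈? A) (con a)
  erase-level (var α)    = keepIf-level (aVar α ∈? A) (var α)
  erase-level ω          = ℕ.z≤n
  erase-level (σ ⇒ τ)    = ℕ.s≤s (ℕ.⊔-mono-≤ (erase-level σ) (erase-level τ))
  erase-level (σ ∩ τ)    = ℕ.⊔-mono-≤ (erase-level σ) (erase-level τ)
  erase-level (ctor c τ) =
    ℕ.≤-trans (keepIf-level (aCtor c ∈? A) (ctor c (erase τ))) (ℕ.s≤s (erase-level τ))

  erase-atoms : ∀ σ → atoms (erase σ) ⊆ A
  erase-atoms (con a) x∈ with aConst a ∈? A
  erase-atoms (con a) (here refl) | yes a∈A = a∈A
  erase-atoms (var α) x∈ with aVar α ∈? A
  erase-atoms (var α) (here refl) | yes α∈A = α∈A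
  erase-atoms (σ ⇒ τ) x∈ with ∈-++⁻ (atoms (erase σ)) x∈
  ... | inj₁ x∈σ = erase-atoms σ x∈σ
  ... | inj₂ x∈τ = erase-atoms τ x∈τ
  erase-atoms (σ ∩ τ) x∈ with ∈-++⁻ (atoms (erase σ)) x∈
  ... | inj₁ x∈σ = erase-atoms σ x∈σ
  ... | inj₂ x∈τ = erase-atoms τ x∈τ
  erase-atoms (ctor c τ) x∈ with aCtor c ∈? A
  erase-atoms (ctor c τ) (here refl) | yes c∈A = c∈A
  erase-atoms (ctor c τ) (there x∈τ) | yes _   = erase-atoms τ x∈τ

  erase-fixed : ∀ σ → atoms σ ⊆ A → erase σ ≡ σ
  erase-fixed (con a) σ⊆A with aConst a ∈? A
  ... | yes _   = refl
  ... | no  a∉A = ⊥-elim (a∉A (σ⊆A (here refl)))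
  erase-fixed (var α) σ⊆A with aVar α ∈? A
  ... | yes _   = refl
  ... | no  α∉A = ⊥-elim (α∉A (σ⊆A (here refl)))
  erase-fixed ω          _   = refl
  erase-fixed (σ ⇒ τ)    σ⊆A =
    cong₂ _⇒_ (erase-fixed σ (σ⊆A ∘ ∈-++⁺ˡ)) (erase-fixed τ (σ⊆A ∘ ∈-++⁺ʳ (atoms σ)))
  erase-fixed (σ ∩ τ)    σ⊆A =
    cong₂ _∩_ (erase-fixed σ (σ⊆A ∘ ∈-++⁺ˡ)) (erase-fixed τ (σ⊆A ∘ ∈-++⁺ʳ (atoms σ)))
  erase-fixed (ctor c τ) σ⊆A with aCtor c ∈? A
  ... | yes _   = cong (ctor c) (erase-fixed τ (σ⊆A ∘ there))
  ... | no  c∉A = ⊥-elim (c∉A (σ⊆A (here refl)))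

  erase-⇒* : ∀ {n} (σs : Vec Ty n) τ → erase (σs ⇒* τ) ≡ Vec.map erase σs ⇒* erase τ
  erase-⇒* []       τ = refl
  erase-⇒* (σ ∷ σs) τ = cong (erase σ ⇒_) (erase-⇒* σs τ)

  eraseS : Subst → Subst
  eraseS = map (map₂ erase)

  dom-eraseS : ∀ S → dom (eraseS S) ≡ dom S
  dom-eraseS S = sym (map-∘ S)

  lookupS-eraseS : ∀ S {α} → α ∈ dom S ⊎ aVar α ∈ A →
                   lookupS (eraseS S) α ≡ erase (lookupS S α)
  lookupS-eraseS [] {α} (inj₂ α∈A) = sym (erase-fixed (var α) λ { (here refl) → α∈A })
  lookupS-eraseS ((β , σ) ∷ S) {α} h with α ≡ᵇ β in α≡ᵇβ
  ... | true  = refl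
  ... | false = lookupS-eraseS S (skip h)
    where
    skip : α ∈ β ∷ dom S ⊎ aVar α ∈ A → α ∈ dom S ⊎ aVar α ∈ A
    skip (inj₁ (here refl)) = ⊥-elim (subst T α≡ᵇβ (ℕ.≡⇒≡ᵇ α α refl))
    skip (inj₁ (there α∈))  = inj₁ α∈
    skip (inj₂ α∈A)         = inj₂ α∈A

  applyS-eraseS : ∀ S τ → atoms τ ⊆ A → applyS (eraseS S) τ ≡ erase (applyS S τ)
  applyS-eraseS S (con a)    τ⊆A = sym (erase-fixed (con a) τ⊆A)
  applyS-eraseS S (var α)    τ⊆A = lookupS-eraseS S (inj₂ (τ⊆A (here refl)))
  applyS-eraseS S ω          _   = refl
  applyS-eraseS S (σ ⇒ τ)    τ⊆A =
    cong₂ _⇒_ (applyS-eraseS S σ (τ⊆A ∘ ∈-++⁺ˡ)) (applyS-eraseS S τ (τ⊆A ∘ ∈-++⁺ʳ (atoms σ)))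
  applyS-eraseS S (σ ∩ τ)    τ⊆A =
    cong₂ _∩_ (applyS-eraseS S σ (τ⊆A ∘ ∈-++⁺ˡ)) (applyS-eraseS S τ (τ⊆A ∘ ∈-++⁺ʳ (atoms σ)))
  applyS-eraseS S (ctor c τ) τ⊆A with aCtor c ∈? A
  ... | yes _   = cong (ctor c) (applyS-eraseS S τ (τ⊆A ∘ there))
  ... | no  c∉A = ⊥-elim (c∉A (τ⊆A (here refl)))

  eraseS-level : ∀ S → LevelS≤ S k → LevelS≤ (eraseS S) k
  eraseS-level {k} S lv = subst (All _) (sym (dom-eraseS S)) (All.tabulate λ {α} α∈ →
    subst (λ σ → level σ ℕ.≤ k) (sym (lookupS-eraseS S (inj₁ α∈)))
      (ℕ.≤-trans (erase-level (lookupS S α)) (All.lookup lv α∈)))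

  eraseS-atoms : ∀ S → atomsS (eraseS S) ⊆ A
  eraseS-atoms S {x} x∈ =
    let α , α∈ , x∈α = find (∈-concatMap⁻ (λ α → atoms (lookupS (eraseS S) α)) x∈)
        α∈S = subst (α ∈_) (dom-eraseS S) α∈
    in erase-atoms (lookupS S α) (subst (λ σ → x ∈ atoms σ) (lookupS-eraseS S (inj₁ α∈S)) x∈α)

  erase-⊢ : ∀ {Δ E} → atomsΔ Δ ⊆ A → Δ ⊢[ k ] E ∶ σ → Δ ⊢[ k ] E ∶ erase σ
  erase-⊢ {k} {Δ = Δ} Δ⊆A (var-rule {C} {τ} {S} C∈ lv) =
    subst (Δ ⊢[ k ] comb C ∶_) (applyS-eraseS S τ (Δ⊆A ∘ atoms-∈Δ C∈))
      (var-rule C∈ (eraseS-level S lv))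
  erase-⊢ Δ⊆A (→E ⊢E ⊢E′)    = →E (erase-⊢ Δ⊆A ⊢E) (erase-⊢ Δ⊆A ⊢E′)
  erase-⊢ Δ⊆A (∩I ⊢₁ ⊢₂)     = ∩I (erase-⊢ Δ⊆A ⊢₁) (erase-⊢ Δ⊆A ⊢₂)
  erase-⊢ Δ⊆A (≤-rule ⊢E le) = ≤-rule (erase-⊢ Δ⊆A ⊢E) (erase-mono le)

repo-functional : ∀ {Δ C τ τ′} → WellFormedRepo Δ → (C , τ) ∈ Δ → (C , τ′) ∈ Δ → τ ≡ τ′
repo-functional (_ ∷ _)    (here refl) (here refl) = refl
repo-functional (C∉ ∷ _)   (here refl) (there C∈)  = ⊥-elim (All.lookup C∉ (∈-map⁺ proj₁ C∈) refl)
repo-functional (C∉ ∷ _)   (there C∈)  (here refl) = ⊥-elim (All.lookup C∉ (∈-map⁺ proj₁ C∈) refl)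
repo-functional (_ ∷ uniq) (there C∈)  (there C∈′) = repo-functional uniq C∈ C∈′

InstancePath : ℕ → List Atom → Ty → Ty → Set
InstancePath k A τC π = Σ Subst λ S → LevelS≤ S k × atomsS S ⊆ A × π ∈ paths (applyS S τC)

instance-strict : ∀ {k A τC π} → InstancePath k A τC π → Strict π
instance-strict {τC = τC} (S , _ , _ , π∈) = paths-strict (applyS S τC) π∈

module _ {Δ : Repository} {k : ℕ} {A : List Atom}
         (wf : WellFormedRepo Δ) (Δ⊆A : atomsΔ Δ ⊆ A) where
  open Erasure A

  comb-inversion : ∀ {C τC} → (C , τC) ∈ Δ → Δ ⊢[ k ] comb C ∶ ρ →
    Σ (List Ty) λ Π → All (InstancePath k A τC) Π × ⋂ Π ≤ₜ erase ρ
  comb-inversion {τC = τC} C∈ (var-rule {S = S} C∈′ lv) with repo-functional wf C∈ C∈′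
  ... | refl =
    paths (applyS (eraseS S) τC) ,
    All.tabulate (λ π∈ → eraseS S , eraseS-level S lv , eraseS-atoms S , π∈) ,
    subst (⋂ (paths (applyS (eraseS S) τC)) ≤ₜ_) (applyS-eraseS S τC (Δ⊆A ∘ atoms-∈Δ C∈))
      (⋂-paths (applyS (eraseS S) τC))
  comb-inversion C∈ (∩I ⊢₁ ⊢₂) =
    let Π₁ , inst₁ , Π₁≤ = comb-inversion C∈ ⊢₁
        Π₂ , inst₂ , Π₂≤ = comb-inversion C∈ ⊢₂
    in Π₁ ++ Π₂ , ++⁺ inst₁ inst₂ , ⋂-++ Π₁ Π₂ Π₁≤ Π₂≤
  comb-inversion C∈ (≤-rule ⊢C le) =
    let Π , inst , Π≤ = comb-inversion C∈ ⊢C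
    in Π , inst , ≤-trans Π≤ (erase-mono le)

module _ {Δ : Repository} {k m : ℕ} {C : ℕ} {τC τ : Ty} (Es : Vec Term m) where

  PathWitness : List Ty → Set
  PathWitness P =
      All (InPm⋂ Δ k τ m τC) P
    × (⋂ (map (tgt m) P) ≤ₜ τ)
    × ((i : Fin m) → Δ ⊢[ k ] lookup Es i ∶ ⋂ (map (arg i) P))

  derivation⇒paths : WellFormedRepo Δ → (C , τC) ∈ Δ →
    Δ ⊢[ k ] applyAll (comb C) Es ∶ τ → Σ (List Ty) PathWitness
  derivation⇒paths wf C∈ ⊢CEs =
    let σs , ⊢C , ⊢Es = applyAll-inversion (comb C) Es ⊢CEs
        Π , Π-inst , Π≤ = comb-inversion wf Δ⊆A C∈ ⊢C
        P , P⊆Π , P-arity , P-args , P-tgt =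
          select-paths (Vec.map erase σs) τ Π (All.map (instance-strict {τC = τC}) Π-inst)
            (subst (⋂ Π ≤ₜ_) (trans (erase-⇒* σs τ) (cong (Vec.map erase σs ⇒*_) τ-fixed)) Π≤)
    in P ,
       All.zipWith (uncurry with-arity) (anti-mono P⊆Π Π-inst , P-arity) ,
       P-tgt ,
       λ i → ≤-rule (erase-⊢ Δ⊆A (⊢Es i))
                    (subst (_≤ₜ ⋂ (map (arg i) P)) (lookup-map i erase σs) (P-args i))
    where
    A : List Atom
    A = atomsΔ Δ ++ atoms τ
    open Erasure A
    Δ⊆A : atomsΔ Δ ⊆ A
    Δ⊆A = ∈-++⁺ˡ
    τ-fixed : erase τ ≡ τ
    τ-fixed = erase-fixed τ (∈-++⁺ʳ (atomsΔ Δ))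
    with-arity : ∀ {π} → InstancePath k A τC π → ArityAtLeast m π → InPm⋂ Δ k τ m τC π
    with-arity (S , lv , at , π∈) ar = S , lv , at , π∈ , ar

  paths⇒derivation : (C , τC) ∈ Δ → Σ (List Ty) PathWitness → Δ ⊢[ k ] applyAll (comb C) Es ∶ τ
  paths⇒derivation C∈ (P , P-inst , P-tgt , ⊢Es) =
    ≤-rule (applyAll-paths (comb C) Es P P-arity ⊢C ⊢Es) P-tgt
    where
    P-arity : All (ArityAtLeast m) P
    P-arity = All.map (λ (_ , _ , _ , _ , ar) → ar) P-inst
    ⊢C : Δ ⊢[ k ] comb C ∶ ⋂ P
    ⊢C = ⊢-⋂ (var-rule C∈ [])
           (All.map (λ (_ , lv , _ , π∈ , _) → ≤-rule (var-rule C∈ lv) (≤-paths _ π∈)) P-inst)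

lemma4p11 : (Δ : Repository) → WellFormedRepo Δ →
    (C : ℕ) (τC : Ty) → (C , τC) ∈ Δ →
    (m : ℕ) (Es : Vec Term m) (τ : Ty) (k : ℕ) →
    (Δ ⊢[ k ] applyAll (comb C) Es ∶ τ)
      ⇔
    (Σ (List Ty) λ P →
        All (InPm⋂ Δ k τ m τC) P
      × (⋂ (map (tgt m) P) ≤ₜ τ)
      × ((i : Fin m) → Δ ⊢[ k ] lookup Es i ∶ ⋂ (map (arg i) P)))
lemma4p11 Δ wf C τC C∈ m Es τ k = mk⇔ (derivation⇒paths Es wf C∈) (paths⇒derivation Es C∈)
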